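{- Suppose $0\le t<n$ are integers. Then $\lambda_{n,t,r+1}<\lambda_{n,t,r}$ for all integers $0\le r<t$.
   Context: For integers $0\le r\le m$, let $H_{m,r}:=\frac{1}{2r+1}\prod_{j=0}^{r-1}\frac{m+j+2}{m-j}$ (empty product $=1$); equivalently $H_{m,r}=\frac{(m+r+1)!(m-r)!}{(2r+1)(m!)^2(m+1)}$, the squared norm $\frac1{m+1}\sum_{x=0}^m Q_r^{(m)}(x)^2$ of the Hahn polynomial $Q_r^{(m)}(x)=\sum_{\ell=0}^r(-1)^\ell\binom r\ell\binom{r+\ell}{\ell}\frac{x^{\underline\ell}}{m^{\underline\ell}}$, where $x^{\underline\ell}=x(x-1)\cdots(x-\ell+1)$. For $0\le r\le t\le n$ define $\lambda_{n,t,r}:=\sqrt{H_{n,r}/H_{t,r}}$. -}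

module Defs where

open import Data.Nat as ℕ using (ℕ; suc; _+_; _*_; _∸_; _!)
open import Data.Nat.Properties using (m*n≢0; _!≢0)
open import Data.Integer using (+_)
open import Data.Rational using (ℚ; 0ℚ; _÷_; ≢-nonZero) renaming (_/_ to _/ℚ_)
open import Data.Rational.Properties using (_≟_)
open import Relation.Nullary using (yes; no)

-- H_{m,r} = (m+r+1)! (m-r)! / ((2r+1) (m!)^2 (m+1))   (as an exact rational;
-- the intended range is r ≤ m, where m ∸ r is genuine subtraction)
H : ℕ → ℕ → ℚ
H m r = (+ ((suc (m + r)) ! * (m ∸ r) !)) /ℚ den
  where
  den : ℕ
  den = suc (2 * r) * (m ! * m !) * suc m
  instance
    _ : ℕ.NonZero (m ! * m !)
    _ = m*n≢0 (m !) (m !) {{(m) !≢0}} {{(m) !≢0}}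
    _ : ℕ.NonZero (suc (2 * r) * (m ! * m !))
    _ = m*n≢0 (suc (2 * r)) (m ! * m !)
    _ : ℕ.NonZero den
    _ = m*n≢0 (suc (2 * r) * (m ! * m !)) (suc m)

-- total division on ℚ (x / 0 := 0; never used with a zero divisor below)
divℚ : ℚ → ℚ → ℚ
divℚ p q with q ≟ 0ℚ
... | yes _ = 0ℚ
... | no q≢0 = (p ÷ q) {{≢-nonZero q≢0}}

λSq : ℕ → ℕ → ℕ → ℚ
λSq n t r = divℚ (H n r) (H t r)

{-# OPTIONS --safe #-}
-- H_{m,r+1} / H_{m,r} = (2r+1)(m+r+2) / ((2r+3)(m-r)), so
-- λ²_{n,t,r+1} / λ²_{n,t,r} = (n+r+2)(t-r) / ((n-r)(t+r+2)), and this is < 1 because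
-- (n-r)(t+r+2) - (n+r+2)(t-r) = 2(n-t)(r+1) > 0.  Cross-multiplied, everything becomes an
-- inequality of natural numbers in which the factorials and the factors (m!)²(m+1) shared by
-- H_{m,r} and H_{m,r+1} cancel.
module Submission where

open import Defs
open import Data.Nat using (ℕ; suc; _<_)
open import Data.Rational using () renaming (_<_ to _<ℚ_)

open import Data.Nat using (_+_; _*_; _∸_; _≤_; _!; NonZero; ≢-nonZero⁻¹)
open import Data.Nat.Properties
  using ( +-suc; *-comm; *-assoc; *-distribʳ-+; *-distribˡ-+; +-monoʳ-<; *-monoʳ-<; *-monoˡ-<
        ; <-trans; ≤-trans; <⇒≤; +-∸-assoc; ∸-monoˡ-<; m∸n+n≡m; m*n≢0; _!*_!≢0; *-commutativeSemigroup
        ; module ≤-Reasoning)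
open import Data.Nat.Tactic.RingSolver using (solve-∀)
open import Algebra.Properties.CommutativeSemigroup *-commutativeSemigroup using (interchange; x∙yz≈y∙xz)
open import Data.Integer as ℤ using (+_; +<+)
open import Data.Integer.Properties using (pos-*)
import Data.Rational as ℚ
import Data.Rational.Properties as ℚₚ
open import Data.Rational.Unnormalised as ℚᵘ using (mkℚᵘ; _≃_; *<*)
import Data.Rational.Unnormalised.Properties as ℚᵘₚ
open import Relation.Binary.PropositionalEquality
open import Relation.Nullary using (yes; no; contradiction)

[n+o]*m<n*[m+o] : ∀ o .{{_ : NonZero o}} {m n} → m < n → (n + o) * m < n * (m + o)
[n+o]*m<n*[m+o] o {m} {n} m<n = begin-strict
  (n + o) * m   ≡⟨ *-distribʳ-+ m n o ⟩
  n * m + o * m <⟨ +-monoʳ-< (n * m) (*-monoʳ-< o m<n) ⟩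
  n * m + o * n ≡⟨ cong (_+_ (n * m)) (*-comm o n) ⟩
  n * m + n * o ≡⟨ *-distribˡ-+ n m o ⟨
  n * (m + o)   ∎
  where open ≤-Reasoning

toℚᵘ-/ : ∀ i d .{{_ : NonZero d}} → ℚ.toℚᵘ (i ℚ./ d) ≃ i ℚᵘ./ d
toℚᵘ-/ i (suc d) = ℚₚ.toℚᵘ-fromℚᵘ (mkℚᵘ i d)

/-*-/ : ∀ a b c d .{{_ : NonZero b}} .{{_ : NonZero d}} →
        (+ a ℚᵘ./ b) ℚᵘ.* (+ c ℚᵘ./ d) ≡ (+ (a * c) ℚᵘ./ (b * d)) {{m*n≢0 b d}}
/-*-/ a (suc b) c (suc d) = ℚᵘₚ./-cong (sym (pos-* a c)) refl

/-<-/ : ∀ a b c d .{{_ : NonZero b}} .{{_ : NonZero d}} → a * d < c * b → + a ℚᵘ./ b ℚᵘ.< + c ℚᵘ./ d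
/-<-/ a (suc b) c (suc d) ad<cb = *<* (subst₂ ℤ._<_ (pos-* a (suc d)) (pos-* c (suc b)) (+<+ ad<cb))

divℚ-nonZero : ∀ p q .{{_ : ℚ.NonZero q}} → divℚ p q ≡ p ℚ.÷ q
divℚ-nonZero p q with q ℚₚ.≟ ℚ.0ℚ
... | yes refl = contradiction refl (≢-nonZero⁻¹ 0)  -- NonZero 0ℚ unfolds to ℕ.NonZero 0
... | no _     = refl

÷-*-cancelʳ : ∀ p q .{{_ : ℚ.NonZero q}} → (p ℚ.÷ q) ℚ.* q ≡ p
÷-*-cancelʳ p q = begin
  p ℚ.* ℚ.1/ q ℚ.* q     ≡⟨ ℚₚ.*-assoc p (ℚ.1/ q) q ⟩
  p ℚ.* (ℚ.1/ q ℚ.* q)   ≡⟨ cong (p ℚ.*_) (ℚₚ.*-inverseˡ q) ⟩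
  p ℚ.* ℚ.1ℚ             ≡⟨ ℚₚ.*-identityʳ p ⟩
  p                      ∎
  where open ≡-Reasoning

÷-<-÷ : ∀ {p q r s} .{{_ : ℚ.Positive q}} .{{_ : ℚ.Positive s}} →
        p ℚ.* s <ℚ r ℚ.* q → (p ℚ.÷ q) {{ℚₚ.pos⇒nonZero q}} <ℚ (r ℚ.÷ s) {{ℚₚ.pos⇒nonZero s}}
÷-<-÷ {p} {q} {r} {s} ps<rq = ℚₚ.*-cancelʳ-<-nonNeg (q ℚ.* s) (begin-strict
  (p ℚ.÷ q) ℚ.* (q ℚ.* s)   ≡⟨ ℚₚ.*-assoc (p ℚ.÷ q) q s ⟨
  (p ℚ.÷ q) ℚ.* q ℚ.* s     ≡⟨ cong (ℚ._* s) (÷-*-cancelʳ p q) ⟩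
  p ℚ.* s                   <⟨ ps<rq ⟩
  r ℚ.* q                   ≡⟨ cong (ℚ._* q) (÷-*-cancelʳ r s) ⟨
  (r ℚ.÷ s) ℚ.* s ℚ.* q     ≡⟨ ℚₚ.*-assoc (r ℚ.÷ s) s q ⟩
  (r ℚ.÷ s) ℚ.* (s ℚ.* q)   ≡⟨ cong ((r ℚ.÷ s) ℚ.*_) (ℚₚ.*-comm s q) ⟩
  (r ℚ.÷ s) ℚ.* (q ℚ.* s)   ∎)
  where
  open ℚₚ.≤-Reasoning
  instance
    _ = ℚₚ.pos⇒nonZero q
    _ = ℚₚ.pos⇒nonZero s
    _ = ℚₚ.pos⇒nonNeg (q ℚ.* s) {{ℚₚ.pos*pos⇒pos q s}}

2+m+r≡[m∸r]+2+2r : ∀ {m r} → r ≤ m → suc (suc (m + r)) ≡ (m ∸ r) + suc (suc (r + r))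
2+m+r≡[m∸r]+2+2r {m} {r} r≤m = begin
  suc (suc (m + r))             ≡⟨ cong (λ k → suc (suc (k + r))) (m∸n+n≡m r≤m) ⟨
  suc (suc (m ∸ r + r + r))     ≡⟨ reassociate (m ∸ r) r ⟩
  (m ∸ r) + suc (suc (r + r))   ∎
  where
  open ≡-Reasoning
  reassociate : ∀ a r → suc (suc (a + r + r)) ≡ a + suc (suc (r + r))
  reassociate = solve-∀

ratio-cross : ∀ {n t r} → r ≤ t → t < n → suc (suc (n + r)) * (t ∸ r) < (n ∸ r) * suc (suc (t + r))
ratio-cross {n} {t} {r} r≤t t<n =
  subst₂ _<_ (cong (_* (t ∸ r)) (sym (2+m+r≡[m∸r]+2+2r (≤-trans r≤t (<⇒≤ t<n)))))
             (cong ((n ∸ r) *_) (sym (2+m+r≡[m∸r]+2+2r r≤t)))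
             ([n+o]*m<n*[m+o] (suc (suc (r + r))) (∸-monoˡ-< t<n r≤t))

-- H m r is definitionally the fraction + Num m r / Den m r.
Num : ℕ → ℕ → ℕ
Num m r = suc (m + r) ! * (m ∸ r) !

Den : ℕ → ℕ → ℕ
Den m r = suc (2 * r) * (m ! * m !) * suc m

Common : ℕ → ℕ → ℕ
Common m r = suc (m + r) ! * (m ∸ suc r) !

Common-nonZero : ∀ m r → NonZero (Common m r)
Common-nonZero m r = suc (m + r) !* (m ∸ suc r) !≢0

Num-nonZero : ∀ m r → NonZero (Num m r)
Num-nonZero m r = suc (m + r) !* (m ∸ r) !≢0

Den-nonZero : ∀ m r → NonZero (Den m r)
Den-nonZero m r = m*n≢0 _ (suc m) {{m*n≢0 (suc (2 * r)) _ {{_}} {{m !* m !≢0}}}}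

Den*Den-nonZero : ∀ m r m′ r′ → NonZero (Den m r * Den m′ r′)
Den*Den-nonZero m r m′ r′ = m*n≢0 _ _ {{Den-nonZero m r}} {{Den-nonZero m′ r′}}

Num[1+r]≡[2+m+r]*Common : ∀ m r → Num m (suc r) ≡ suc (suc (m + r)) * Common m r
Num[1+r]≡[2+m+r]*Common m r = begin
  suc (m + suc r) ! * (m ∸ suc r) !                   ≡⟨ cong (λ k → suc k ! * (m ∸ suc r) !) (+-suc m r) ⟩
  suc (suc (m + r)) * suc (m + r) ! * (m ∸ suc r) !   ≡⟨ *-assoc (suc (suc (m + r))) (suc (m + r) !) ((m ∸ suc r) !) ⟩
  suc (suc (m + r)) * Common m r                      ∎
  where open ≡-Reasoning

Num≡[m∸r]*Common : ∀ {m r} → r < m → Num m r ≡ (m ∸ r) * Common m r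
Num≡[m∸r]*Common {m} {r} r<m = begin
  suc (m + r) ! * (m ∸ r) !                         ≡⟨ cong (λ k → suc (m + r) ! * k !) m∸r≡1+[m∸1+r] ⟩
  suc (m + r) ! * (suc (m ∸ suc r) * (m ∸ suc r) !) ≡⟨ x∙yz≈y∙xz (suc (m + r) !) (suc (m ∸ suc r)) ((m ∸ suc r) !) ⟩
  suc (m ∸ suc r) * Common m r                      ≡⟨ cong (_* Common m r) m∸r≡1+[m∸1+r] ⟨
  (m ∸ r) * Common m r                              ∎
  where
  open ≡-Reasoning
  m∸r≡1+[m∸1+r] : m ∸ r ≡ suc (m ∸ suc r)
  m∸r≡1+[m∸1+r] = +-∸-assoc 1 r<m

Num-cross : ∀ {n t r} → r < t → t < n → Num n (suc r) * Num t r < Num n r * Num t (suc r)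
Num-cross {n} {t} {r} r<t t<n = begin-strict
  Num n (suc r) * Num t r                       ≡⟨ cong₂ _*_ (Num[1+r]≡[2+m+r]*Common n r) (Num≡[m∸r]*Common r<t) ⟩
  (suc (suc (n + r)) * Cₙ) * ((t ∸ r) * Cₜ)     ≡⟨ interchange (suc (suc (n + r))) Cₙ (t ∸ r) Cₜ ⟩
  (suc (suc (n + r)) * (t ∸ r)) * (Cₙ * Cₜ)     <⟨ *-monoˡ-< (Cₙ * Cₜ) (ratio-cross (<⇒≤ r<t) t<n) ⟩
  ((n ∸ r) * suc (suc (t + r))) * (Cₙ * Cₜ)     ≡⟨ interchange (n ∸ r) Cₙ (suc (suc (t + r))) Cₜ ⟨
  ((n ∸ r) * Cₙ) * (suc (suc (t + r)) * Cₜ)     ≡⟨ cong₂ _*_ (Num≡[m∸r]*Common (<-trans r<t t<n)) (Num[1+r]≡[2+m+r]*Common t r) ⟨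
  Num n r * Num t (suc r)                       ∎
  where
  open ≤-Reasoning
  Cₙ = Common n r
  Cₜ = Common t r
  instance
    _ : NonZero (Cₙ * Cₜ)
    _ = m*n≢0 Cₙ Cₜ {{Common-nonZero n r}} {{Common-nonZero t r}}

Den-swap : ∀ n t r → Den n r * Den t (suc r) ≡ Den n (suc r) * Den t r
Den-swap n t r = swap (suc (2 * r)) (suc (2 * suc r)) (n ! * n !) (suc n) (t ! * t !) (suc t)
  where
  swap : ∀ p q a b c d → p * a * b * (q * c * d) ≡ q * a * b * (p * c * d)
  swap = solve-∀

Num-Den-cross : ∀ {n t r} → r < t → t < n →
  Num n (suc r) * Num t r * (Den n r * Den t (suc r)) < Num n r * Num t (suc r) * (Den n (suc r) * Den t r)
Num-Den-cross {n} {t} {r} r<t t<n rewrite Den-swap n t r =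
  *-monoˡ-< (Den n (suc r) * Den t r) {{Den*Den-nonZero n (suc r) t r}} (Num-cross r<t t<n)

toℚᵘ-H*H : ∀ m r m′ r′ →
  ℚ.toℚᵘ (H m r ℚ.* H m′ r′) ≃ (+ (Num m r * Num m′ r′) ℚᵘ./ (Den m r * Den m′ r′)) {{Den*Den-nonZero m r m′ r′}}
toℚᵘ-H*H m r m′ r′ = begin-equality
  ℚ.toℚᵘ (H m r ℚ.* H m′ r′)                                  ≃⟨ ℚₚ.toℚᵘ-homo-* (H m r) (H m′ r′) ⟩
  ℚ.toℚᵘ (H m r) ℚᵘ.* ℚ.toℚᵘ (H m′ r′)                        ≃⟨ ℚᵘₚ.*-cong (toℚᵘ-/ _ (Den m r)) (toℚᵘ-/ _ (Den m′ r′)) ⟩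
  (+ Num m r ℚᵘ./ Den m r) ℚᵘ.* (+ Num m′ r′ ℚᵘ./ Den m′ r′) ≡⟨ /-*-/ (Num m r) (Den m r) (Num m′ r′) (Den m′ r′) ⟩
  + (Num m r * Num m′ r′) ℚᵘ./ (Den m r * Den m′ r′)          ∎
  where
  open ℚᵘₚ.≤-Reasoning
  instance
    _ = Den-nonZero m r
    _ = Den-nonZero m′ r′
    _ = Den*Den-nonZero m r m′ r′

H-cross : ∀ {n t r} → r < t → t < n → H n (suc r) ℚ.* H t r <ℚ H n r ℚ.* H t (suc r)
H-cross {n} {t} {r} r<t t<n = ℚₚ.toℚᵘ-cancel-< (begin-strict
  ℚ.toℚᵘ (H n (suc r) ℚ.* H t r)                                       ≃⟨ toℚᵘ-H*H n (suc r) t r ⟩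
  + (Num n (suc r) * Num t r) ℚᵘ./ (Den n (suc r) * Den t r)           <⟨ /-<-/ _ _ _ _ (Num-Den-cross r<t t<n) ⟩
  + (Num n r * Num t (suc r)) ℚᵘ./ (Den n r * Den t (suc r))           ≃⟨ toℚᵘ-H*H n r t (suc r) ⟨
  ℚ.toℚᵘ (H n r ℚ.* H t (suc r))                                       ∎)
  where
  open ℚᵘₚ.≤-Reasoning
  instance
    _ = Den*Den-nonZero n (suc r) t r
    _ = Den*Den-nonZero n r t (suc r)

H-positive : ∀ m r → ℚ.Positive (H m r)
H-positive m r = ℚₚ.normalize-pos (Num m r) (Den m r) {{Den-nonZero m r}} {{Num-nonZero m r}}

lemma1 : (n t : ℕ) → t < n → (r : ℕ) → r < t →
           λSq n t (suc r) <ℚ λSq n t r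
lemma1 n t t<n r r<t = begin-strict
  λSq n t (suc r)              ≡⟨ divℚ-nonZero (H n (suc r)) (H t (suc r)) ⟩
  H n (suc r) ℚ.÷ H t (suc r)  <⟨ ÷-<-÷ {H n (suc r)} {H t (suc r)} {H n r} {H t r} (H-cross r<t t<n) ⟩
  H n r ℚ.÷ H t r              ≡⟨ divℚ-nonZero (H n r) (H t r) ⟨
  λSq n t r                    ∎
  where
  open ℚₚ.≤-Reasoning
  instance
    _ = H-positive t r
    _ = H-positive t (suc r)
    _ = ℚₚ.pos⇒nonZero (H t r)
    _ = ℚₚ.pos⇒nonZero (H t (suc r))
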